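{- Let $G$ be an undirected graph, and let $G'$ be obtained from $G$ by replacing every edge $e=\{u,v\}$ by a path of length three $u, x_e, y_e, v$, where $x_e,y_e$ are new vertices. Then $G$ and $G'$ have the same number of Euler tours, and the Euler tours of $G'$ are in bijection with the Hamiltonian cycles of the line graph $L(G')$.
   Context: An Euler tour is a closed walk traversing every edge exactly once. The line graph $L(H)$ of an undirected graph $H=(V,E)$ has vertex set $E$, with two distinct edges adjacent iff they share an endpoint in $H$. -}

module Defs where

open import Data.Nat using (ℕ; zero; suc; _+_; _*_; _%_)
open import Data.Nat.DivMod using (m%n<n)
open import Data.Fin using (Fin; zero; suc; toℕ; fromℕ<; _↑ˡ_; _↑ʳ_; combine; remQuot; opposite)
open import Data.Product using (Σ; Σ-syntax; ∃; _×_; _,_; proj₁; proj₂)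
open import Data.Sum using (_⊎_)
open import Relation.Binary.PropositionalEquality using (_≡_; _≢_)
open import Function using (_∘_)

record Graph : Set where
  field
    V    : ℕ
    E    : ℕ
    ends : Fin E → Fin V × Fin V
open Graph public

Joins : (G : Graph) → Fin (E G) → Fin (V G) → Fin (V G) → Set
Joins G e a b = ends G e ≡ (a , b) ⊎ ends G e ≡ (b , a)

Incident : (G : Graph) → Fin (V G) → Fin (E G) → Set
Incident G a e = proj₁ (ends G e) ≡ a ⊎ proj₂ (ends G e) ≡ a

IsSimple : Graph → Set
IsSimple G =
  (∀ e → proj₁ (ends G e) ≢ proj₂ (ends G e)) ×
  (∀ e f → Joins G f (proj₁ (ends G e)) (proj₂ (ends G e)) → e ≡ f)

csuc : ∀ {k} → Fin k → Fin k
csuc {suc k} i = fromℕ< (m%n<n (suc (toℕ i)) (suc k))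

shift : ∀ {k} → ℕ → Fin k → Fin k
shift zero    i = i
shift (suc s) i = csuc (shift s i)

-- Two cyclic sequences are equal up to rotation and reversal
-- (they describe the same closed walk / cycle).
CycEq : ∀ {k} {A : Set} → (Fin k → A) → (Fin k → A) → Set
CycEq w w' = Σ[ s ∈ ℕ ] ((∀ i → w' i ≡ w (shift s i))
                       ⊎ (∀ i → w' i ≡ w (opposite (shift s i))))

ExactlyOnce : ∀ {k n} → (Fin k → Fin n) → Set
ExactlyOnce {k} {n} w = ∀ (x : Fin n) → Σ[ i ∈ Fin k ] (w i ≡ x × (∀ j → w j ≡ x → j ≡ i))

-- Euler tours: a closed walk traversing every edge exactly once,
-- recorded as its cyclic sequence of edges w 0, …, w (E-1), with a
-- vertex sequence v such that edge w i goes from v i to v (i+1 mod E).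

IsEulerTour : (G : Graph) → (Fin (E G) → Fin (E G)) → Set
IsEulerTour G w =
  ExactlyOnce w ×
  Σ[ v ∈ (Fin (E G) → Fin (V G)) ] (∀ i → Joins G (w i) (v i) (v (csuc i)))

EulerTour : Graph → Set
EulerTour G = Σ[ w ∈ (Fin (E G) → Fin (E G)) ] IsEulerTour G w

SameTour : (G : Graph) → EulerTour G → EulerTour G → Set
SameTour G t t' = CycEq (proj₁ t) (proj₁ t')

record AdjGraph : Set₁ where
  field
    N   : ℕ
    Adj : Fin N → Fin N → Set
open AdjGraph public

IsHamCycle : (H : AdjGraph) → (Fin (N H) → Fin (N H)) → Set
IsHamCycle H h = ExactlyOnce h × (∀ i → Adj H (h i) (h (csuc i)))

HamCycle : AdjGraph → Set
HamCycle H = Σ[ h ∈ (Fin (N H) → Fin (N H)) ] IsHamCycle H h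

SameCycle : (H : AdjGraph) → HamCycle H → HamCycle H → Set
SameCycle H c c' = CycEq (proj₁ c) (proj₁ c')

LineGraph : Graph → AdjGraph
LineGraph G = record
  { N   = E G
  ; Adj = λ e f → e ≢ f × Σ[ a ∈ Fin (V G) ] (Incident G a e × Incident G a f)
  }

-- Vertices: Fin (V + E*2); old vertex u ↦ u ↑ˡ (E*2),
--   x_e = V ↑ʳ combine e 0,  y_e = V ↑ʳ combine e 1.
-- Edges: Fin (E*3); edge combine e 0 = {u,x_e}, combine e 1 = {x_e,y_e},
--   combine e 2 = {y_e,v}.

subdivEnds : (G : Graph) → Fin (E G) → Fin 3 → Fin (V G + E G * 2) × Fin (V G + E G * 2)
subdivEnds G e j = step j
  where
  old : Fin (V G) → Fin (V G + E G * 2)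
  old a = a ↑ˡ (E G * 2)
  x y : Fin (V G + E G * 2)
  x = V G ↑ʳ combine e zero
  y = V G ↑ʳ combine e (suc zero)
  step : Fin 3 → Fin (V G + E G * 2) × Fin (V G + E G * 2)
  step zero             = old (proj₁ (ends G e)) , x
  step (suc zero)       = x , y
  step (suc (suc zero)) = y , old (proj₂ (ends G e))

subdivide : Graph → Graph
subdivide G = record
  { V    = V G + E G * 2
  ; E    = E G * 3
  ; ends = λ k → subdivEnds G (proj₁ (remQuot {E G} 3 k)) (proj₂ (remQuot {E G} 3 k))
  }

-- "A and B have the same number of elements up to the equivalences ~A, ~B":
-- a map inducing a bijection between the classes.

record ClassBij {A B : Set} (_~A_ : A → A → Set) (_~B_ : B → B → Set) : Set where
  field
    to        : A → B
    respects  : ∀ a a' → a ~A a' → to a ~B to a'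
    reflects  : ∀ a a' → to a ~B to a' → a ~A a'
    surjective : ∀ b → Σ[ a ∈ A ] (to a ~B b)

{-# OPTIONS --safe #-}
module Submission where

-- Traversing an edge e = {u, v} of G in one direction corresponds to traversing the path u, x_e, y_e, v of G′
-- in the same direction, so an Euler tour of G expands, edge by edge, to an Euler tour of G′. As G is simple,
-- the direction in which a tour crosses an edge is determined by the next edge, so the expansion depends on the
-- edge sequence alone and commutes with rotation and reversal; it loses nothing, because the middle edges
-- x_e y_e of the expansion still spell out the original tour. Conversely, in L(G′) the middle edge x_e y_e is
-- adjacent only to the two outer edges of its own path, so a Hamiltonian cycle of L(G′) runs through every path
-- in one piece, consecutive paths meet in a vertex of G, and contracting the paths gives an Euler tour of G
-- whose expansion is the cycle up to rotation. Finally, consecutive edges of an Euler tour share a vertex, so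
-- the Euler tours of G′ are the Hamiltonian cycles of L(G′), with the same identification up to rotation and
-- reversal.

open import Defs
open import Data.Nat using (ℕ; zero; suc; _+_; _*_; _%_; _∸_; _<_; z≤n; s≤s; s≤s⁻¹)
open import Data.Nat.Properties
  using (+-identityʳ; +-suc; +-comm; +-assoc; *-comm; <⇒≢; <⇒≤; m≤n⇒m<n∨m≡n; m∸n≤m; n∸n≡0;
         +-∸-assoc; m+[n∸m]≡n; m+n∸m≡n; m≤n⇒∃[o]m+o≡n)
open import Data.Nat.DivMod
  using (m%n<n; m<n⇒m%n≡m; %-distribˡ-+; m%n%n≡m%n; [m+n]%n≡m%n; n%n≡0; m%n*o≡m*o%[n*o];
         [m*n+o]%[p*n]≡[m*n]%[p*n]+o)
open import Data.Nat.Tactic.RingSolver using (solve-∀)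
open import Data.Bool using (Bool; true; false; not)
import Data.Bool as Bool
open import Data.Bool.Properties using (¬-not)
open import Data.Fin
  using (Fin; zero; suc; toℕ; combine; remQuot; quotient; opposite; inject₁; fromℕ; _↑ˡ_; _↑ʳ_; splitAt)
import Data.Fin as Fin
open import Data.Fin.Patterns using (0F; 1F; 2F)
open import Data.Fin.Properties
  using (toℕ-injective; toℕ-fromℕ<; toℕ<n; toℕ-inject₁; toℕ-fromℕ; opposite-prop; opposite-involutive;
         toℕ-combine; remQuot-combine; combine-remQuot; combine-injective; combine-injectiveˡ;
         combine-injectiveʳ; combine-surjective; ↑ˡ-injective; ↑ʳ-injective; splitAt-↑ˡ; splitAt-↑ʳ)
open import Data.Product using (Σ-syntax; _×_; _,_; proj₁; proj₂; map₂)
open import Data.Sum using (_⊎_; inj₁; inj₂)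
open import Data.Empty using (⊥-elim)
open import Relation.Nullary using (Dec; yes; no; ¬_; does)
open import Relation.Nullary.Decidable using (_⊎-dec_; dec-true; dec-false)
open import Relation.Binary.PropositionalEquality
  using (_≡_; _≢_; refl; sym; trans; cong; cong₂; subst; subst₂; module ≡-Reasoning)
open import Function using (_∘_)

-- Cyclic shifts

toℕ-csuc : ∀ {n} (i : Fin (suc n)) → toℕ (csuc i) ≡ suc (toℕ i) % suc n
toℕ-csuc {n} i = toℕ-fromℕ< (m%n<n (suc (toℕ i)) (suc n))

[1+m%n]%n≡[1+m]%n : ∀ m n → suc (m % suc n) % suc n ≡ suc m % suc n
[1+m%n]%n≡[1+m]%n m n = begin
  (1 + m % suc n) % suc n                 ≡⟨ %-distribˡ-+ 1 (m % suc n) (suc n) ⟩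
  (1 % suc n + m % suc n % suc n) % suc n ≡⟨ cong (λ r → (1 % suc n + r) % suc n) (m%n%n≡m%n m (suc n)) ⟩
  (1 % suc n + m % suc n) % suc n         ≡⟨ %-distribˡ-+ 1 m (suc n) ⟨
  (1 + m) % suc n                         ∎
  where open ≡-Reasoning

toℕ-shift : ∀ {n} t (i : Fin (suc n)) → toℕ (shift t i) ≡ (toℕ i + t) % suc n
toℕ-shift {n} zero i = begin
  toℕ i               ≡⟨ m<n⇒m%n≡m (toℕ<n i) ⟨
  toℕ i % suc n       ≡⟨ cong (_% suc n) (+-identityʳ (toℕ i)) ⟨
  (toℕ i + 0) % suc n ∎
  where open ≡-Reasoning
toℕ-shift {n} (suc t) i = begin
  toℕ (csuc (shift t i))            ≡⟨ toℕ-csuc (shift t i) ⟩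
  suc (toℕ (shift t i)) % suc n     ≡⟨ cong (λ r → suc r % suc n) (toℕ-shift t i) ⟩
  suc ((toℕ i + t) % suc n) % suc n ≡⟨ [1+m%n]%n≡[1+m]%n (toℕ i + t) n ⟩
  suc (toℕ i + t) % suc n           ≡⟨ cong (_% suc n) (+-suc (toℕ i) t) ⟨
  (toℕ i + suc t) % suc n           ∎
  where open ≡-Reasoning

shift-+ : ∀ {k} s t (i : Fin k) → shift (s + t) i ≡ shift s (shift t i)
shift-+ zero    t i = refl
shift-+ (suc s) t i = cong csuc (shift-+ s t i)

shift-csuc : ∀ {k} t (i : Fin k) → shift t (csuc i) ≡ csuc (shift t i)
shift-csuc zero    i = refl
shift-csuc (suc t) i = cong csuc (shift-csuc t i)

shift-comm : ∀ {k} s t (i : Fin k) → shift s (shift t i) ≡ shift t (shift s i)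
shift-comm s t i = begin
  shift s (shift t i) ≡⟨ shift-+ s t i ⟨
  shift (s + t) i     ≡⟨ cong (λ r → shift r i) (+-comm s t) ⟩
  shift (t + s) i     ≡⟨ shift-+ t s i ⟩
  shift t (shift s i) ∎
  where open ≡-Reasoning

shift-transitive : ∀ {k} (i j : Fin k) → Σ[ t ∈ ℕ ] shift t i ≡ j
shift-transitive {suc n} i j = J + (suc n ∸ I) , toℕ-injective (begin
  toℕ (shift (J + (suc n ∸ I)) i) ≡⟨ toℕ-shift _ i ⟩
  (I + (J + (suc n ∸ I))) % suc n ≡⟨ cong (_% suc n) round-trip ⟩
  (J + suc n) % suc n             ≡⟨ [m+n]%n≡m%n J (suc n) ⟩
  J % suc n                       ≡⟨ m<n⇒m%n≡m (toℕ<n j) ⟩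
  J                               ∎)
  where
  open ≡-Reasoning
  I J : ℕ
  I = toℕ i
  J = toℕ j
  round-trip : I + (J + (suc n ∸ I)) ≡ J + suc n
  round-trip = begin
    I + (J + (suc n ∸ I)) ≡⟨ +-assoc I J _ ⟨
    I + J + (suc n ∸ I)   ≡⟨ cong (_+ (suc n ∸ I)) (+-comm I J) ⟩
    J + I + (suc n ∸ I)   ≡⟨ +-assoc J I _ ⟩
    J + (I + (suc n ∸ I)) ≡⟨ cong (J +_) (m+[n∸m]≡n (<⇒≤ (toℕ<n i))) ⟩
    J + suc n             ∎

csuc-equivariant-unique : ∀ {k} {B : Set} (F : B → B) (φ ψ : Fin k → B) →
  (∀ i → φ (csuc i) ≡ F (φ i)) → (∀ i → ψ (csuc i) ≡ F (ψ i)) →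
  ∀ i₀ → φ i₀ ≡ ψ i₀ → ∀ i → φ i ≡ ψ i
csuc-equivariant-unique F φ ψ φ-eq ψ-eq i₀ φi₀≡ψi₀ i with shift-transitive i₀ i
... | t , refl = along t
  where
  along : ∀ t → φ (shift t i₀) ≡ ψ (shift t i₀)
  along zero    = φi₀≡ψi₀
  along (suc t) = trans (φ-eq _) (trans (cong F (along t)) (sym (ψ-eq _)))

csuc-commuting⇒shift : ∀ {k} (ρ : Fin k → Fin k) → (∀ i → ρ (csuc i) ≡ csuc (ρ i)) →
                       Σ[ r ∈ ℕ ] (∀ i → ρ i ≡ shift r i)
csuc-commuting⇒shift {zero}  ρ ρ-csuc = 0 , λ ()
csuc-commuting⇒shift {suc n} ρ ρ-csuc with shift-transitive zero (ρ zero)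
... | r , shift-r-0 =
  r , csuc-equivariant-unique csuc ρ (shift r) ρ-csuc (shift-csuc r) zero (sym shift-r-0)

shift-fixes⇒id : ∀ {k} t {i₀ : Fin k} → shift t i₀ ≡ i₀ → ∀ i → shift t i ≡ i
shift-fixes⇒id t {i₀} = csuc-equivariant-unique csuc (shift t) (λ i → i) (shift-csuc t) (λ _ → refl) i₀

shift-inverse : ∀ {k} t → Σ[ u ∈ ℕ ] (∀ (i : Fin k) → shift u (shift t i) ≡ i)
shift-inverse {zero}  t = 0 , λ ()
shift-inverse {suc n} t with shift-transitive (shift t zero) zero
... | u , back =
  u , λ i → trans (sym (shift-+ u t i)) (shift-fixes⇒id (u + t) (trans (shift-+ u t zero) back) i)

cpred : ∀ {k} → Fin k → Fin k
cpred {k} = shift (proj₁ (shift-inverse {k} 1))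

cpred-csuc : ∀ {k} (i : Fin k) → cpred (csuc i) ≡ i
cpred-csuc {k} = proj₂ (shift-inverse {k} 1)

csuc-cpred : ∀ {k} (i : Fin k) → csuc (cpred i) ≡ i
csuc-cpred {k} i = trans (sym (shift-csuc (proj₁ (shift-inverse {k} 1)) i)) (cpred-csuc i)

csuc-injective : ∀ {k} {i j : Fin k} → csuc i ≡ csuc j → i ≡ j
csuc-injective {i = i} {j} eq = trans (sym (cpred-csuc i)) (trans (cong cpred eq) (cpred-csuc j))

shift-≢ : ∀ {k} t (i : Fin k) → 0 < t → t < k → shift t i ≢ i
shift-≢ {suc n} t i 0<t t<k fix = <⇒≢ 0<t (sym (begin
  t                        ≡⟨ m<n⇒m%n≡m t<k ⟨
  t % suc n                ≡⟨ toℕ-shift t (zero {n}) ⟨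
  toℕ (shift t (zero {n})) ≡⟨ cong toℕ (shift-fixes⇒id t fix zero) ⟩
  0                        ∎))
  where open ≡-Reasoning

csuc-opposite-csuc : ∀ {k} (x : Fin k) → csuc (opposite (csuc x)) ≡ opposite x
csuc-opposite-csuc {suc n} x = toℕ-injective (begin
  toℕ (csuc (opposite (csuc x)))        ≡⟨ toℕ-csuc (opposite (csuc x)) ⟩
  suc (toℕ (opposite (csuc x))) % suc n ≡⟨ cong (λ r → suc r % suc n) (opposite-prop (csuc x)) ⟩
  suc (n ∸ toℕ (csuc x)) % suc n        ≡⟨ by-cases (m≤n⇒m<n∨m≡n (s≤s⁻¹ (toℕ<n x))) ⟩
  toℕ (opposite x)                      ∎)
  where
  open ≡-Reasoning
  by-cases : toℕ x < n ⊎ toℕ x ≡ n → suc (n ∸ toℕ (csuc x)) % suc n ≡ toℕ (opposite x)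
  by-cases (inj₁ x<n) = begin
    suc (n ∸ toℕ (csuc x)) % suc n ≡⟨ cong (λ r → suc (n ∸ r) % suc n) csuc-x≡1+x ⟩
    suc (n ∸ suc (toℕ x)) % suc n  ≡⟨ cong (_% suc n) (+-∸-assoc 1 x<n) ⟨
    (n ∸ toℕ x) % suc n            ≡⟨ m<n⇒m%n≡m (s≤s (m∸n≤m n (toℕ x))) ⟩
    n ∸ toℕ x                      ≡⟨ opposite-prop x ⟨
    toℕ (opposite x)               ∎
    where
    csuc-x≡1+x : toℕ (csuc x) ≡ suc (toℕ x)
    csuc-x≡1+x = trans (toℕ-csuc x) (m<n⇒m%n≡m (s≤s x<n))
  by-cases (inj₂ x≡n) = begin
    suc (n ∸ toℕ (csuc x)) % suc n ≡⟨ cong (λ r → suc (n ∸ r) % suc n) csuc-x≡0 ⟩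
    suc n % suc n                  ≡⟨ n%n≡0 (suc n) ⟩
    0                              ≡⟨ n∸n≡0 n ⟨
    n ∸ n                          ≡⟨ cong (n ∸_) x≡n ⟨
    n ∸ toℕ x                      ≡⟨ opposite-prop x ⟨
    toℕ (opposite x)               ∎
    where
    csuc-x≡0 : toℕ (csuc x) ≡ 0
    csuc-x≡0 = trans (toℕ-csuc x) (trans (cong (λ r → suc r % suc n) x≡n) (n%n≡0 (suc n)))

-- Blocks of positions

blockwise : ∀ {m k} {A : Set} → (Fin m → Fin k → A) → Fin (m * k) → A
blockwise {m} {k} f x = f (proj₁ (remQuot {m} k x)) (proj₂ (remQuot {m} k x))

blockwise-combine : ∀ {m k} {A : Set} (f : Fin m → Fin k → A) a j →
                    blockwise f (combine a j) ≡ f a j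
blockwise-combine {m} {k} f a j = cong (λ p → f (proj₁ p) (proj₂ p)) (remQuot-combine {m} {k} a j)

combine-induction : ∀ {m k} (P : Fin (m * k) → Set) → (∀ a j → P (combine a j)) → ∀ x → P x
combine-induction {m} {k} P P-combine x =
  subst P (combine-remQuot {m} k x) (P-combine (proj₁ (remQuot {m} k x)) (proj₂ (remQuot {m} k x)))

shift-combine : ∀ {m k} t s (a : Fin m) (j j′ : Fin k) → toℕ j + t ≡ s * k + toℕ j′ →
                shift t (combine a j) ≡ combine (shift s a) j′
shift-combine {suc m} {suc k} t s a j j′ carry = toℕ-injective (begin
  toℕ (shift t (combine a j))            ≡⟨ toℕ-shift t (combine a j) ⟩
  (toℕ (combine a j) + t) % M            ≡⟨ cong (λ r → (r + t) % M) (toℕ-combine a j) ⟩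
  (suc k * A + toℕ j + t) % M            ≡⟨ cong (_% M) regroup ⟩
  ((A + s) * suc k + toℕ j′) % M         ≡⟨ [m*n+o]%[p*n]≡[m*n]%[p*n]+o (A + s) (suc m) (toℕ<n j′) ⟩
  (A + s) * suc k % M + toℕ j′           ≡⟨ cong (_+ toℕ j′) (m%n*o≡m*o%[n*o] (A + s) (suc m) (suc k)) ⟨
  (A + s) % suc m * suc k + toℕ j′       ≡⟨ cong (λ r → r * suc k + toℕ j′) (toℕ-shift s a) ⟨
  toℕ (shift s a) * suc k + toℕ j′       ≡⟨ cong (_+ toℕ j′) (*-comm (toℕ (shift s a)) (suc k)) ⟩
  suc k * toℕ (shift s a) + toℕ j′       ≡⟨ toℕ-combine (shift s a) j′ ⟨
  toℕ (combine (shift s a) j′)           ∎)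
  where
  open ≡-Reasoning
  M A : ℕ
  M = suc m * suc k
  A = toℕ a
  distribute : ∀ k A s j → k * A + (s * k + j) ≡ (A + s) * k + j
  distribute = solve-∀
  regroup : suc k * A + toℕ j + t ≡ (A + s) * suc k + toℕ j′
  regroup = begin
    suc k * A + toℕ j + t            ≡⟨ +-assoc (suc k * A) (toℕ j) t ⟩
    suc k * A + (toℕ j + t)          ≡⟨ cong (suc k * A +_) carry ⟩
    suc k * A + (s * suc k + toℕ j′) ≡⟨ distribute (suc k) A s (toℕ j′) ⟩
    (A + s) * suc k + toℕ j′         ∎

shift-*-combine : ∀ {m k} s (a : Fin m) (j : Fin k) → shift (s * k) (combine a j) ≡ combine (shift s a) j
shift-*-combine {k = k} s a j = shift-combine (s * k) s a j j (+-comm (toℕ j) (s * k))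

csuc-combine-inject₁ : ∀ {m k} (a : Fin m) (j : Fin k) → csuc (combine a (inject₁ j)) ≡ combine a (suc j)
csuc-combine-inject₁ a j =
  shift-combine 1 0 a (inject₁ j) (suc j) (trans (cong (_+ 1) (toℕ-inject₁ j)) (+-comm (toℕ j) 1))

csuc-combine-fromℕ : ∀ {m} k (a : Fin m) → csuc (combine a (fromℕ k)) ≡ combine (csuc a) zero
csuc-combine-fromℕ k a = shift-combine 1 1 a (fromℕ k) zero (begin
  toℕ (fromℕ k) + 1 ≡⟨ cong (_+ 1) (toℕ-fromℕ k) ⟩
  k + 1             ≡⟨ +-comm k 1 ⟩
  suc k             ≡⟨ +-identityʳ (suc k) ⟨
  suc k + 0         ≡⟨ +-identityʳ (suc k + 0) ⟨
  1 * suc k + 0     ∎)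
  where open ≡-Reasoning

opposite-combine : ∀ {m k} (a : Fin m) (j : Fin k) →
                   opposite (combine a j) ≡ combine (opposite a) (opposite j)
opposite-combine {m} {k} a j = toℕ-injective (begin
  toℕ (opposite (combine a j))              ≡⟨ opposite-prop (combine a j) ⟩
  m * k ∸ suc (toℕ (combine a j))           ≡⟨ cong (λ r → m * k ∸ suc r) (toℕ-combine a j) ⟩
  m * k ∸ suc (k * toℕ a + toℕ j)           ≡⟨ complement (toℕ<n a) (toℕ<n j) ⟩
  k * (m ∸ suc (toℕ a)) + (k ∸ suc (toℕ j))
    ≡⟨ cong₂ (λ r r′ → k * r + r′) (opposite-prop a) (opposite-prop j) ⟨
  k * toℕ (opposite a) + toℕ (opposite j)   ≡⟨ toℕ-combine (opposite a) (opposite j) ⟨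
  toℕ (combine (opposite a) (opposite j))   ∎)
  where
  open ≡-Reasoning
  split : ∀ A J d e → (suc A + d) * (suc J + e) ≡ suc ((suc J + e) * A + J) + ((suc J + e) * d + e)
  split = solve-∀
  complement : ∀ {m k A J} → A < m → J < k → m * k ∸ suc (k * A + J) ≡ k * (m ∸ suc A) + (k ∸ suc J)
  complement {A = A} {J} A<m J<k with m≤n⇒∃[o]m+o≡n A<m | m≤n⇒∃[o]m+o≡n J<k
  ... | d , refl | e , refl rewrite m+n∸m≡n A d | m+n∸m≡n J e =
    trans (cong (_∸ suc ((suc J + e) * A + J)) (split A J d e)) (m+n∸m≡n (suc ((suc J + e) * A + J)) _)

csuc-≢ : ∀ {m} (i : Fin (m * 3)) → csuc i ≢ i
csuc-≢ {suc m} i = shift-≢ 1 i (s≤s z≤n) (s≤s (s≤s z≤n))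

csuc²-≢ : ∀ {m} (i : Fin (m * 3)) → csuc (csuc i) ≢ i
csuc²-≢ {suc m} i = shift-≢ 2 i (s≤s z≤n) (s≤s (s≤s (s≤s z≤n)))

orient : ∀ {k} → Bool → Fin k → Fin k
orient true  j = j
orient false j = opposite j

orient-involutive : ∀ {k} b (j : Fin k) → orient b (orient b j) ≡ j
orient-involutive true  j = refl
orient-involutive false j = opposite-involutive j

orient-not : ∀ {k} b (j : Fin k) → orient (not b) j ≡ orient b (opposite j)
orient-not true  j = refl
orient-not false j = sym (opposite-involutive j)

-- Euler tours and Hamiltonian cycles

ExactlyOnce⇒injective : ∀ {k n} {w : Fin k → Fin n} → ExactlyOnce w → ∀ {i j} → w i ≡ w j → i ≡ j
ExactlyOnce⇒injective {w = w} once {i} {j} wi≡wj with once (w j)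
... | _ , _ , unique = trans (unique i wi≡wj) (sym (unique j refl))

ExactlyOnce-∘ : ∀ {k n} {w : Fin k → Fin n} (σ τ : Fin k → Fin k) →
                (∀ i → σ (τ i) ≡ i) → (∀ i → τ (σ i) ≡ i) →
                ExactlyOnce w → ExactlyOnce (w ∘ σ)
ExactlyOnce-∘ {w = w} σ τ στ τσ once x with once x
... | i , wi≡x , unique = τ i , trans (cong w (στ i)) wi≡x ,
      λ j wσj≡x → trans (sym (τσ j)) (cong τ (unique (σ j) wσj≡x))

ExactlyOnce-blockwise : ∀ {m k} {w : Fin m → Fin m} (σ : Fin m → Fin k → Fin k) →
                        (∀ a j → σ a (σ a j) ≡ j) → ExactlyOnce w →
                        ExactlyOnce (blockwise (λ a j → combine (w a) (σ a j)))
ExactlyOnce-blockwise {m} {k} {w} σ σ-involutive once =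
  combine-induction (λ x → Σ[ y ∈ Fin (m * k) ] (f y ≡ x × (∀ z → f z ≡ x → z ≡ y))) located
  where
  g : Fin m → Fin k → Fin (m * k)
  g a j = combine (w a) (σ a j)
  f : Fin (m * k) → Fin (m * k)
  f = blockwise g
  located : ∀ e j → Σ[ y ∈ Fin (m * k) ] (f y ≡ combine e j × (∀ z → f z ≡ combine e j → z ≡ y))
  located e j with once e
  ... | a , refl , unique = combine a (σ a j) , hit , combine-induction _ only
    where
    hit : f (combine a (σ a j)) ≡ combine (w a) j
    hit = trans (blockwise-combine g a (σ a j)) (cong (combine (w a)) (σ-involutive a j))
    only : ∀ a′ j′ → f (combine a′ j′) ≡ combine (w a) j → combine a′ j′ ≡ combine a (σ a j)
    only a′ j′ eq
      with combine-injective (w a′) (σ a′ j′) (w a) j (trans (sym (blockwise-combine g a′ j′)) eq)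
    ... | wa′≡wa , σj′≡j with unique a′ wa′≡wa
    ... | refl = cong (combine a) (trans (sym (σ-involutive a j′)) (cong (σ a) σj′≡j))

IsHamCycle-∘-shift : ∀ (H : AdjGraph) {h} t → IsHamCycle H h → IsHamCycle H (h ∘ shift t)
IsHamCycle-∘-shift H {h} t (once , adjacent) with shift-inverse {N H} t
... | u , back = ExactlyOnce-∘ (shift t) (shift u) forth back once ,
                 λ i → subst (Adj H (h (shift t i)) ∘ h) (sym (shift-csuc t i)) (adjacent (shift t i))
  where
  forth : ∀ i → shift t (shift u i) ≡ i
  forth i = trans (shift-comm t u i) (back i)

LineGraph-Adj-sym : ∀ (H : Graph) {e f} → Adj (LineGraph H) e f → Adj (LineGraph H) f e
LineGraph-Adj-sym H (e≢f , z , z∈e , z∈f) = (λ f≡e → e≢f (sym f≡e)) , z , z∈f , z∈e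

Fin-inhabited? : ∀ n → Dec (Fin n)
Fin-inhabited? zero    = no λ ()
Fin-inhabited? (suc n) = yes zero

module _ (G : Graph) where

  endpoint : Bool → Fin (E G) → Fin (V G)
  endpoint true  e = proj₁ (ends G e)
  endpoint false e = proj₂ (ends G e)

  Traverses : Bool → Fin (E G) → Fin (V G) → Fin (V G) → Set
  Traverses b e x y = endpoint b e ≡ x × endpoint (not b) e ≡ y

  Joins⇒Traverses : ∀ {e x y} → Joins G e x y → Σ[ b ∈ Bool ] Traverses b e x y
  Joins⇒Traverses (inj₁ eq) = true  , cong proj₁ eq , cong proj₂ eq
  Joins⇒Traverses (inj₂ eq) = false , cong proj₂ eq , cong proj₁ eq

  Traverses⇒Joins : ∀ b {e x y} → Traverses b e x y → Joins G e x y
  Traverses⇒Joins true  (refl , refl) = inj₁ refl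
  Traverses⇒Joins false (refl , refl) = inj₂ refl

  Joins-cong : ∀ {e e′ x x′ y y′} → e ≡ e′ → x ≡ x′ → y ≡ y′ →
               Joins G e′ x′ y′ → Joins G e x y
  Joins-cong refl refl refl joins = joins

  Joins-sym : ∀ {e x y} → Joins G e x y → Joins G e y x
  Joins-sym (inj₁ eq) = inj₂ eq
  Joins-sym (inj₂ eq) = inj₁ eq

  Joins⇒Incidentˡ : ∀ {e x y} → Joins G e x y → Incident G x e
  Joins⇒Incidentˡ (inj₁ eq) = inj₁ (cong proj₁ eq)
  Joins⇒Incidentˡ (inj₂ eq) = inj₂ (cong proj₂ eq)

  Joins⇒Incidentʳ : ∀ {e x y} → Joins G e x y → Incident G y e
  Joins⇒Incidentʳ (inj₁ eq) = inj₂ (cong proj₂ eq)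
  Joins⇒Incidentʳ (inj₂ eq) = inj₁ (cong proj₁ eq)

  Incident-Joins : ∀ {e x y z} → Incident G z e → Joins G e x y → z ≡ x ⊎ z ≡ y
  Incident-Joins (inj₁ refl) (inj₁ eq) = inj₁ (cong proj₁ eq)
  Incident-Joins (inj₂ refl) (inj₁ eq) = inj₂ (cong proj₂ eq)
  Incident-Joins (inj₁ refl) (inj₂ eq) = inj₂ (cong proj₁ eq)
  Incident-Joins (inj₂ refl) (inj₂ eq) = inj₁ (cong proj₂ eq)

  incident? : ∀ x e → Dec (Incident G x e)
  incident? x e = (proj₁ (ends G e) Fin.≟ x) ⊎-dec (proj₂ (ends G e) Fin.≟ x)

  edgeless-EulerTour : ¬ Fin (E G) → EulerTour G
  edgeless-EulerTour no-edge =
    (λ a → a) , (λ a → ⊥-elim (no-edge a)) , (λ a → ⊥-elim (no-edge a)) , (λ a → ⊥-elim (no-edge a))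

  IsEulerTour⇒IsHamCycle : (∀ (i : Fin (E G)) → csuc i ≢ i) →
                            ∀ {w} → IsEulerTour G w → IsHamCycle (LineGraph G) w
  IsEulerTour⇒IsHamCycle csuc≢ {w} (once , v , joins) =
    once , λ i → (λ eq → csuc≢ i (sym (ExactlyOnce⇒injective once eq))) ,
                 v (csuc i) , Joins⇒Incidentʳ (joins i) , Joins⇒Incidentˡ (joins (csuc i))

  -- The direction in which e is crossed when f comes next: forwards iff the second endpoint of e lies on f.
  -- It depends on the edge sequence only; that it is the actual direction needs simplicity
  -- (direction-Traverses).
  forward : Fin (E G) → Fin (E G) → Bool
  forward e f = does (incident? (endpoint false e) f)

  direction : (Fin (E G) → Fin (E G)) → Fin (E G) → Bool
  direction w a = forward (w a) (w (csuc a))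

module _ (G : Graph) (simple : IsSimple G) where

  Joins⇒≢ : ∀ {e x y} → Joins G e x y → x ≢ y
  Joins⇒≢ {e} (inj₁ eq) refl = proj₁ simple e (trans (cong proj₁ eq) (sym (cong proj₂ eq)))
  Joins⇒≢ {e} (inj₂ eq) refl = proj₁ simple e (trans (cong proj₁ eq) (sym (cong proj₂ eq)))

  Joins-unique : ∀ {e f x y} → Joins G e x y → Joins G f x y → e ≡ f
  Joins-unique {e} {f} (inj₁ eq) f-joins =
    proj₂ simple e f (subst (λ p → Joins G f (proj₁ p) (proj₂ p)) (sym eq) f-joins)
  Joins-unique {e} {f} (inj₂ eq) f-joins =
    proj₂ simple e f (subst (λ p → Joins G f (proj₁ p) (proj₂ p)) (sym eq) (Joins-sym G f-joins))

  endpoint-injective : ∀ {b d} e → endpoint G b e ≡ endpoint G d e → b ≡ d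
  endpoint-injective {true}  {true}  e _  = refl
  endpoint-injective {false} {false} e _  = refl
  endpoint-injective {true}  {false} e eq = ⊥-elim (proj₁ simple e eq)
  endpoint-injective {false} {true}  e eq = ⊥-elim (proj₁ simple e (sym eq))

  module EulerTourOf {w} (tour : IsEulerTour G w) where

    v : Fin (E G) → Fin (V G)
    v = proj₁ (proj₂ tour)

    joins : ∀ a → Joins G (w a) (v a) (v (csuc a))
    joins = proj₂ (proj₂ tour)

    consecutive-common-vertex : ∀ {a x} → Incident G x (w a) → Incident G x (w (csuc a)) → x ≡ v (csuc a)
    consecutive-common-vertex {a} {x} x∈wa x∈wa⁺
      with Incident-Joins G x∈wa (joins a) | Incident-Joins G x∈wa⁺ (joins (csuc a))
    ... | inj₂ x≡v⁺ | _          = x≡v⁺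
    ... | _         | inj₁ x≡v⁺  = x≡v⁺
    ... | inj₁ x≡v  | inj₂ x≡v⁺⁺ =
      ⊥-elim (Joins⇒≢ (joins a) (cong v (ExactlyOnce⇒injective (proj₁ tour) parallel)))
      where
      parallel : w a ≡ w (csuc a)
      parallel = Joins-unique (joins a) (subst (λ z → Joins G (w (csuc a)) z (v (csuc a)))
                                               (trans (sym x≡v⁺⁺) x≡v) (Joins-sym G (joins (csuc a))))

    direction-Traverses : ∀ a → Traverses G (direction G w a) (w a) (v a) (v (csuc a))
    direction-Traverses a with Joins⇒Traverses G (joins a)
    ... | true , T = subst (λ b → Traverses G b (w a) (v a) (v (csuc a))) (sym forwards) T
      where
      forwards : direction G w a ≡ true
      forwards = dec-true (incident? G _ _)
        (subst (λ z → Incident G z (w (csuc a))) (sym (proj₂ T)) (Joins⇒Incidentˡ G (joins (csuc a))))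
    ... | false , T = subst (λ b → Traverses G b (w a) (v a) (v (csuc a))) (sym backwards) T
      where
      backwards : direction G w a ≡ false
      backwards = dec-false (incident? G _ _) λ x∈wa⁺ →
        Joins⇒≢ (joins a) (trans (sym (proj₁ T)) (consecutive-common-vertex (inj₂ refl) x∈wa⁺))

    forward-previous : ∀ a → forward G (w (csuc a)) (w a) ≡ not (direction G w (csuc a))
    forward-previous a with direction G w (csuc a) | direction-Traverses (csuc a)
    ... | true  | _ , head = dec-false (incident? G _ _) λ x∈wa →
      Joins⇒≢ (joins (csuc a)) (trans (sym (consecutive-common-vertex x∈wa (inj₂ refl))) head)
    ... | false | tail , _ = dec-true (incident? G _ _)
      (subst (λ z → Incident G z (w a)) (sym tail) (Joins⇒Incidentʳ G (joins a)))

-- The subdivided graph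

module Subdivision (G : Graph) where

  G′ : Graph
  G′ = subdivide G

  old : Fin (V G) → Fin (V G′)
  old x = x ↑ˡ (E G * 2)

  side : Bool → Fin 2
  side true  = zero
  side false = suc zero

  -- inner true e = x_e and inner false e = y_e
  inner : Bool → Fin (E G) → Fin (V G′)
  inner b e = V G ↑ʳ combine e (side b)

  old-injective : ∀ {x y} → old x ≡ old y → x ≡ y
  old-injective = ↑ˡ-injective (E G * 2) _ _

  inner-injective : ∀ {b d e f} → inner b e ≡ inner d f → b ≡ d × e ≡ f
  inner-injective {b} {d} {e} {f} eq
    with combine-injective e (side b) f (side d) (↑ʳ-injective (V G) _ _ eq)
  inner-injective {true}  {true}  eq | e≡f , _ = refl , e≡f
  inner-injective {false} {false} eq | e≡f , _ = refl , e≡f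
  inner-injective {true}  {false} eq | _ , ()
  inner-injective {false} {true}  eq | _ , ()

  old≢inner : ∀ {x b e} → old x ≢ inner b e
  old≢inner {x} eq with trans (sym (splitAt-↑ˡ (V G) x (E G * 2)))
                              (trans (cong (splitAt (V G)) eq) (splitAt-↑ʳ (V G) (E G * 2) _))
  ... | ()

  -- The path replacing e, walked from endpoint G b e.
  traversal : Bool → Fin (E G) → Fin 3 → Fin (E G′)
  traversal b e j = combine e (orient b j)

  middle : Fin (E G) → Fin (E G′)
  middle e = combine e 1F

  endEdge : Bool → Fin (E G) → Fin (E G′)
  endEdge b e = traversal b e 0F

  orient-1F : ∀ b → orient {3} b 1F ≡ 1F
  orient-1F true  = refl
  orient-1F false = refl

  traversal-middle : ∀ b e → traversal b e 1F ≡ middle e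
  traversal-middle b e = cong (combine e) (orient-1F b)

  traversal-last : ∀ b e → traversal b e 2F ≡ endEdge (not b) e
  traversal-last true  e = refl
  traversal-last false e = refl

  middle≢endEdge : ∀ {b e f} → middle f ≢ endEdge b e
  middle≢endEdge {true}  {e} {f} eq with combine-injectiveʳ f 1F e 0F eq
  ... | ()
  middle≢endEdge {false} {e} {f} eq with combine-injectiveʳ f 1F e 2F eq
  ... | ()

  ends-combine : ∀ e j → ends G′ (combine e j) ≡ subdivEnds G e j
  ends-combine = blockwise-combine (subdivEnds G)

  Joins-first : ∀ b {e x y} → Traverses G b e x y → Joins G′ (traversal b e 0F) (old x) (inner b e)
  Joins-first true  (refl , _) = inj₁ (ends-combine _ 0F)
  Joins-first false (refl , _) = inj₂ (ends-combine _ 2F)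

  Joins-middle : ∀ b e → Joins G′ (traversal b e 1F) (inner b e) (inner (not b) e)
  Joins-middle true  e = inj₁ (ends-combine e 1F)
  Joins-middle false e = inj₂ (ends-combine e 1F)

  Joins-last : ∀ b {e x y} → Traverses G b e x y →
               Joins G′ (traversal b e 2F) (inner (not b) e) (old y)
  Joins-last true  (_ , refl) = inj₁ (ends-combine _ 2F)
  Joins-last false (_ , refl) = inj₂ (ends-combine _ 0F)

  Incident-combine : ∀ {z e j} → Incident G′ z (combine e j) →
                     proj₁ (subdivEnds G e j) ≡ z ⊎ proj₂ (subdivEnds G e j) ≡ z
  Incident-combine {z} {e} {j} = subst (λ p → proj₁ p ≡ z ⊎ proj₂ p ≡ z) (ends-combine e j)

  Incident-middle : ∀ {z e} → Incident G′ z (middle e) → Σ[ b ∈ Bool ] z ≡ inner b e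
  Incident-middle z∈e with Incident-combine z∈e
  ... | inj₁ eq = true  , sym eq
  ... | inj₂ eq = false , sym eq

  Incident-endEdge : ∀ {z} b e → Incident G′ z (endEdge b e) → z ≡ old (endpoint G b e) ⊎ z ≡ inner b e
  Incident-endEdge true  e z∈e with Incident-combine z∈e
  ... | inj₁ eq = inj₁ (sym eq)
  ... | inj₂ eq = inj₂ (sym eq)
  Incident-endEdge false e z∈e with Incident-combine z∈e
  ... | inj₁ eq = inj₂ (sym eq)
  ... | inj₂ eq = inj₁ (sym eq)

  middle⊎endEdge : ∀ x → (Σ[ e ∈ Fin (E G) ] x ≡ middle e) ⊎
                         (Σ[ b ∈ Bool ] Σ[ e ∈ Fin (E G) ] x ≡ endEdge b e)
  middle⊎endEdge x with combine-surjective {E G} {3} x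
  ... | e , 0F , refl = inj₂ (true , e , refl)
  ... | e , 1F , refl = inj₁ (e , refl)
  ... | e , 2F , refl = inj₂ (false , e , refl)

  Adj′ : Fin (E G′) → Fin (E G′) → Set
  Adj′ = Adj (LineGraph G′)

  middle-adjacent : ∀ {e y} → Adj′ (middle e) y → Σ[ b ∈ Bool ] y ≡ endEdge b e
  middle-adjacent {e} {y} (distinct , z , z∈e , z∈y) with Incident-middle z∈e | middle⊎endEdge y
  ... | b , refl | inj₁ (f , refl) with Incident-middle z∈y
  ...   | _ , z≡f = ⊥-elim (distinct (cong middle (proj₂ (inner-injective z≡f))))
  middle-adjacent {e} {y} (distinct , z , z∈e , z∈y) | b , refl | inj₂ (d , f , refl)
    with Incident-endEdge d f z∈y
  ...   | inj₁ z≡old = ⊥-elim (old≢inner (sym z≡old))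
  ...   | inj₂ z≡f with inner-injective z≡f
  ...     | refl , refl = b , refl

  endEdge-adjacent : ∀ {b d e f} → Adj′ (endEdge b e) (endEdge d f) → endpoint G b e ≡ endpoint G d f
  endEdge-adjacent {b} {d} {e} {f} (distinct , z , z∈e , z∈f)
    with Incident-endEdge b e z∈e | Incident-endEdge d f z∈f
  ... | inj₁ p | inj₁ q = old-injective (trans (sym p) q)
  ... | inj₁ p | inj₂ q = ⊥-elim (old≢inner (trans (sym p) q))
  ... | inj₂ p | inj₁ q = ⊥-elim (old≢inner (trans (sym q) p))
  ... | inj₂ p | inj₂ q with inner-injective (trans (sym p) q)
  ...   | refl , refl = ⊥-elim (distinct refl)

  expand : (Fin (E G) → Fin (E G)) → Fin (E G′) → Fin (E G′)
  expand w = blockwise (λ a → traversal (direction G w a) (w a))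

  expand-combine : ∀ w a j → expand w (combine a j) ≡ traversal (direction G w a) (w a) j
  expand-combine w = blockwise-combine (λ a → traversal (direction G w a) (w a))

  expand-middle⁻¹ : ∀ u x {e} → expand u x ≡ middle e →
                    Σ[ b ∈ Fin (E G) ] (x ≡ combine b 1F × u b ≡ e)
  expand-middle⁻¹ u x eq with combine-surjective {E G} {3} x
  ... | b , j , refl with combine-injective (u b) _ _ 1F (trans (sym (expand-combine u b j)) eq)
  ...   | ub≡e , oj≡1 = b , cong (combine b) j≡1 , ub≡e
    where
    d : Bool
    d = direction G u b
    j≡1 : j ≡ 1F
    j≡1 = trans (sym (orient-involutive d j)) (trans (cong (orient d) oj≡1) (orient-1F d))

  expand-shift : ∀ {w w′} s → (∀ a → w′ a ≡ w (shift s a)) →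
                 ∀ x → expand w′ x ≡ expand w (shift (s * 3) x)
  expand-shift {w} {w′} s rotated = combine-induction _ λ a j → begin
    expand w′ (combine a j)                   ≡⟨ expand-combine w′ a j ⟩
    traversal (direction G w′ a) (w′ a) j     ≡⟨ cong₂ (λ b e → traversal b e j) (direction-eq a) (rotated a) ⟩
    traversal (direction G w (shift s a)) (w (shift s a)) j
                                              ≡⟨ expand-combine w (shift s a) j ⟨
    expand w (combine (shift s a) j)          ≡⟨ cong (expand w) (shift-*-combine s a j) ⟨
    expand w (shift (s * 3) (combine a j))    ∎
    where
    open ≡-Reasoning
    direction-eq : ∀ a → direction G w′ a ≡ direction G w (shift s a)
    direction-eq a = cong₂ (forward G) (rotated a) (trans (rotated (csuc a)) (cong w (shift-csuc s a)))

  -- Orientations fix middle edges, so the rotation carries the middle of each block to the middle of a block;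
  -- the induced map on blocks commutes with csuc, hence is itself a rotation.
  expand-shift⁻¹ : ∀ {w′ u} t → (∀ x → expand w′ x ≡ expand u (shift t x)) →
                   Σ[ r ∈ ℕ ] (∀ a → w′ a ≡ u (shift r a))
  expand-shift⁻¹ {w′} {u} t rotated =
    proj₁ ρ-rotation , λ a → trans (sym (proj₂ (proj₂ (located a)))) (cong u (proj₂ ρ-rotation a))
    where
    open ≡-Reasoning
    located : ∀ a → Σ[ b ∈ Fin (E G) ] (shift t (combine a 1F) ≡ combine b 1F × u b ≡ w′ a)
    located a = expand-middle⁻¹ u _ (trans (sym (rotated (combine a 1F)))
      (trans (expand-combine w′ a 1F) (traversal-middle (direction G w′ a) (w′ a))))
    ρ : Fin (E G) → Fin (E G)
    ρ a = proj₁ (located a)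
    ρ-csuc : ∀ a → ρ (csuc a) ≡ csuc (ρ a)
    ρ-csuc a = combine-injectiveˡ _ 1F _ 1F (begin
      combine (ρ (csuc a)) 1F           ≡⟨ proj₁ (proj₂ (located (csuc a))) ⟨
      shift t (combine (csuc a) 1F)     ≡⟨ cong (shift t) (shift-*-combine 1 a 1F) ⟨
      shift t (shift 3 (combine a 1F))  ≡⟨ shift-comm t 3 _ ⟩
      shift 3 (shift t (combine a 1F))  ≡⟨ cong (shift 3) (proj₁ (proj₂ (located a))) ⟩
      shift 3 (combine (ρ a) 1F)        ≡⟨ shift-*-combine 1 (ρ a) 1F ⟩
      combine (csuc (ρ a)) 1F           ∎)
    ρ-rotation : Σ[ r ∈ ℕ ] (∀ a → ρ a ≡ shift r a)
    ρ-rotation = csuc-commuting⇒shift ρ ρ-csuc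

-- Expanding and contracting tours

module Expansion (G : Graph) (simple : IsSimple G) where

  open Subdivision G

  expand-IsEulerTour : ∀ {w} → IsEulerTour G w → IsEulerTour G′ (expand w)
  expand-IsEulerTour {w} tour =
    ExactlyOnce-blockwise (orient ∘ direction G w) (orient-involutive ∘ direction G w) (proj₁ tour) ,
    v′ , combine-induction {E G} {3} _ step
    where
    open EulerTourOf G simple tour
    vertex : Fin (E G) → Fin 3 → Fin (V G′)
    vertex a 0F = old (v a)
    vertex a 1F = inner (direction G w a) (w a)
    vertex a 2F = inner (not (direction G w a)) (w a)
    v′ : Fin (E G′) → Fin (V G′)
    v′ = blockwise vertex
    step : ∀ a j → Joins G′ (expand w (combine a j)) (v′ (combine a j)) (v′ (csuc (combine a j)))
    step a 0F = Joins-cong G′ (expand-combine w a 0F) (blockwise-combine vertex a 0F)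
      (trans (cong v′ (csuc-combine-inject₁ a 0F)) (blockwise-combine vertex a 1F))
      (Joins-first _ (direction-Traverses a))
    step a 1F = Joins-cong G′ (expand-combine w a 1F) (blockwise-combine vertex a 1F)
      (trans (cong v′ (csuc-combine-inject₁ a 1F)) (blockwise-combine vertex a 2F))
      (Joins-middle _ _)
    step a 2F = Joins-cong G′ (expand-combine w a 2F) (blockwise-combine vertex a 2F)
      (trans (cong v′ (csuc-combine-fromℕ 2 a)) (blockwise-combine vertex (csuc a) 0F))
      (Joins-last _ (direction-Traverses a))

  expandTour : EulerTour G → EulerTour G′
  expandTour (w , tour) = expand w , expand-IsEulerTour tour

  expand-reverse : ∀ {w} → IsEulerTour G w → ∀ x → expand (w ∘ opposite) x ≡ expand w (opposite x)
  expand-reverse {w} tour = combine-induction {E G} {3} _ reversed-block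
    where
    open ≡-Reasoning
    open EulerTourOf G simple tour
    reversed-direction : ∀ a → direction G (w ∘ opposite) a ≡ not (direction G w (opposite a))
    reversed-direction a = begin
      forward G (w (opposite a)) (w r) ≡⟨ cong (λ i → forward G (w i) (w r)) (csuc-opposite-csuc a) ⟨
      forward G (w (csuc r)) (w r)     ≡⟨ forward-previous r ⟩
      not (direction G w (csuc r))     ≡⟨ cong (not ∘ direction G w) (csuc-opposite-csuc a) ⟩
      not (direction G w (opposite a)) ∎
      where
      r : Fin (E G)
      r = opposite (csuc a)
    reversed-block : ∀ a j → expand (w ∘ opposite) (combine a j) ≡ expand w (opposite (combine a j))
    reversed-block a j = begin
      expand (w ∘ opposite) (combine a j)           ≡⟨ expand-combine (w ∘ opposite) a j ⟩
      traversal (direction G (w ∘ opposite) a) e j  ≡⟨ cong (λ b → traversal b e j) (reversed-direction a) ⟩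
      traversal (not b) e j                         ≡⟨ cong (combine e) (orient-not b j) ⟩
      traversal b e (opposite j)                    ≡⟨ expand-combine w (opposite a) (opposite j) ⟨
      expand w (combine (opposite a) (opposite j))  ≡⟨ cong (expand w) (opposite-combine a j) ⟨
      expand w (opposite (combine a j))             ∎
      where
      e : Fin (E G)
      e = w (opposite a)
      b : Bool
      b = direction G w (opposite a)

  expand-respects : ∀ t t′ → SameTour G t t′ → SameTour G′ (expandTour t) (expandTour t′)
  expand-respects (w , _) (w′ , _) (s , inj₁ rotated) = s * 3 , inj₁ (expand-shift {w} {w′} s rotated)
  expand-respects (w , tour) (w′ , _) (s , inj₂ reflected) = s * 3 , inj₂ λ x →
    trans (expand-shift {w ∘ opposite} {w′} s reflected x) (expand-reverse tour (shift (s * 3) x))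

  expand-reflects : ∀ t t′ → SameTour G′ (expandTour t) (expandTour t′) → SameTour G t t′
  expand-reflects (w , _) (w′ , _) (s , inj₁ rotated) = map₂ inj₁ (expand-shift⁻¹ {w′} {w} s rotated)
  expand-reflects (w , tour) (w′ , _) (s , inj₂ reflected) =
    map₂ inj₂ (expand-shift⁻¹ {w′} {w ∘ opposite} s λ x →
      trans (reflected x) (sym (expand-reverse tour (shift s x))))

  module HamiltonianCycle {g} (ham : IsHamCycle (LineGraph G′) g) where

    g-injective : ∀ {x y} → g x ≡ g y → x ≡ y
    g-injective = ExactlyOnce⇒injective (proj₁ ham)

    adjacent : ∀ x → Adj′ (g x) (g (csuc x))
    adjacent = proj₂ ham

    middle-neighbours : ∀ {q f} → g q ≡ middle f →
                        Σ[ b ∈ Bool ] (g (cpred q) ≡ endEdge b f × g (csuc q) ≡ endEdge (not b) f)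
    middle-neighbours {q} {f} gq≡f with middle-adjacent (LineGraph-Adj-sym G′ before) | middle-adjacent after
      where
      before : Adj′ (g (cpred q)) (middle f)
      before = subst (Adj′ (g (cpred q))) (trans (cong g (csuc-cpred q)) gq≡f) (adjacent (cpred q))
      after : Adj′ (middle f) (g (csuc q))
      after = subst (λ x → Adj′ x (g (csuc q))) gq≡f (adjacent q)
    ... | b , gq⁻≡b | d , gq⁺≡d with d Bool.≟ b
    ...   | no d≢b   = b , gq⁻≡b , trans gq⁺≡d (cong (λ d → endEdge d f) (¬-not d≢b))
    ...   | yes refl = ⊥-elim (csuc²-≢ {E G} (cpred q)
                         (g-injective (trans (cong (g ∘ csuc) (csuc-cpred q)) (trans gq⁺≡d (sym gq⁻≡b)))))

    TraversedAs : Fin (E G) → Bool → Fin (E G) → Set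
    TraversedAs a b e = ∀ j → g (combine a j) ≡ traversal b e j

    Traversed : Fin (E G) → Set
    Traversed a = Σ[ b ∈ Bool ] Σ[ e ∈ Fin (E G) ] TraversedAs a b e

    MiddleAt : Fin (E G) → Set
    MiddleAt a = Σ[ e ∈ Fin (E G) ] g (combine a 1F) ≡ middle e

    middle⇒traversed : ∀ {a} → MiddleAt a → Traversed a
    middle⇒traversed {a} (e , ga≡e) with middle-neighbours ga≡e
    ... | b , before , after = b , e , λ where
      0F → trans (cong g (sym (trans (cong cpred (sym (csuc-combine-inject₁ a 0F))) (cpred-csuc _)))) before
      1F → trans ga≡e (sym (traversal-middle b e))
      2F → trans (cong g (sym (csuc-combine-inject₁ a 1F))) (trans after (sym (traversal-last b e)))

    block-end : ∀ {a} b e → TraversedAs a b e → g (combine a 2F) ≡ endEdge (not b) e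
    block-end b e ga = trans (ga 2F) (traversal-last b e)

    after-block : ∀ (a : Fin (E G)) → g (csuc (combine a 2F)) ≡ g (combine (csuc a) 0F)
    after-block a = cong g (csuc-combine-fromℕ 2 a)

    -- A middle edge there would be adjacent to the end edge of e at (a, 2F), hence be the middle of e,
    -- which already sits at (a, 1F).
    after-block≢middle : ∀ {a} b e {f} → TraversedAs a b e → g (combine (csuc a) 0F) ≢ middle f
    after-block≢middle {a} b e {f} ga next≡f
      with middle-adjacent (LineGraph-Adj-sym G′
             (subst₂ Adj′ (block-end b e ga) (trans (after-block a) next≡f) (adjacent (combine a 2F))))
    ... | _ , e-end≡f-end with combine-injectiveʳ a 1F (csuc a) 0F (g-injective (begin
      g (combine a 1F)        ≡⟨ ga 1F ⟩
      traversal b e 1F        ≡⟨ traversal-middle b e ⟩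
      middle e                ≡⟨ cong middle (combine-injectiveˡ _ _ _ _ e-end≡f-end) ⟩
      middle f                ≡⟨ next≡f ⟨
      g (combine (csuc a) 0F) ∎))
      where open ≡-Reasoning
    ... | ()

    -- The middle of f is a cycle neighbour of this end edge of f; it is not the one before it, at (a, 2F),
    -- which holds an end edge, so it is the one after it.
    after-block-end⇒middle : ∀ {a} b e {d f} → TraversedAs a b e → g (combine (csuc a) 0F) ≡ endEdge d f →
                             MiddleAt (csuc a)
    after-block-end⇒middle {a} b e {d} {f} ga next≡f with proj₁ ham (middle f)
    ... | q , gq≡f , _ with middle-neighbours gq≡f
    ...   | b′ , before , after with d Bool.≟ b′
    ...     | yes refl = f , trans (cong g (sym q≡next-middle)) gq≡f
      where
      q≡next-middle : q ≡ combine (csuc a) 1F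
      q≡next-middle = trans (sym (csuc-cpred q))
        (trans (cong csuc (g-injective (trans before (sym next≡f)))) (csuc-combine-inject₁ (csuc a) 0F))
    ...     | no d≢b′ = ⊥-elim (middle≢endEdge {not b} {e} {f} (begin
      middle f          ≡⟨ gq≡f ⟨
      g q               ≡⟨ cong g (csuc-injective (g-injective (begin
                             g (csuc q)              ≡⟨ after ⟩
                             endEdge (not b′) f      ≡⟨ cong (λ d → endEdge d f) (¬-not d≢b′) ⟨
                             endEdge d f             ≡⟨ next≡f ⟨
                             g (combine (csuc a) 0F) ≡⟨ after-block a ⟨
                             g (csuc (combine a 2F)) ∎))) ⟩
      g (combine a 2F)  ≡⟨ block-end b e ga ⟩
      endEdge (not b) e ∎))
      where open ≡-Reasoning

    middle⇒middle-csuc : ∀ {a} → MiddleAt a → MiddleAt (csuc a)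
    middle⇒middle-csuc {a} middle-a with middle⇒traversed middle-a | middle⊎endEdge (g (combine (csuc a) 0F))
    ... | b , e , ga | inj₁ (f , next≡f)     = ⊥-elim (after-block≢middle b e ga next≡f)
    ... | b , e , ga | inj₂ (d , f , next≡f) = after-block-end⇒middle b e {d} ga next≡f

    middle-everywhere : ∀ {a₀} → MiddleAt a₀ → ∀ a → MiddleAt a
    middle-everywhere {a₀} middle-a₀ a with shift-transitive a₀ a
    ... | t , refl = along t
      where
      along : ∀ t → MiddleAt (shift t a₀)
      along zero    = middle-a₀
      along (suc t) = middle⇒middle-csuc (along t)

    module Contraction (traversed : ∀ a → Traversed a) where

      w : Fin (E G) → Fin (E G)
      w a = proj₁ (proj₂ (traversed a))

      dir : Fin (E G) → Bool
      dir a = proj₁ (traversed a)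

      g-block : ∀ a → TraversedAs a (dir a) (w a)
      g-block a = proj₂ (proj₂ (traversed a))

      v : Fin (E G) → Fin (V G)
      v a = endpoint G (dir a) (w a)

      link : ∀ a → endpoint G (not (dir a)) (w a) ≡ v (csuc a)
      link a = endEdge-adjacent {not (dir a)} {dir (csuc a)}
        (subst₂ Adj′ (block-end (dir a) (w a) (g-block a)) (trans (after-block a) (g-block (csuc a) 0F))
                     (adjacent (combine a 2F)))

      w-ExactlyOnce : ExactlyOnce w
      w-ExactlyOnce e with proj₁ ham (middle e)
      ... | q , gq≡e , _ with combine-surjective {E G} {3} q
      ...   | a , j , refl = a , combine-injectiveˡ _ _ _ _ (trans (sym (g-block a j)) gq≡e) , unique
        where
        unique : ∀ a′ → w a′ ≡ e → a′ ≡ a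
        unique a′ refl = combine-injectiveˡ a′ 1F a j (g-injective (begin
          g (combine a′ 1F)       ≡⟨ g-block a′ 1F ⟩
          traversal (dir a′) e 1F ≡⟨ traversal-middle (dir a′) e ⟩
          middle e                ≡⟨ gq≡e ⟨
          g (combine a j)         ∎))
          where open ≡-Reasoning

      w-IsEulerTour : IsEulerTour G w
      w-IsEulerTour = w-ExactlyOnce , v , λ a → Traverses⇒Joins G (dir a) (refl , link a)

      expand-w≡g : ∀ x → expand w x ≡ g x
      expand-w≡g = combine-induction {E G} {3} _ λ a j → begin
        expand w (combine a j)              ≡⟨ expand-combine w a j ⟩
        traversal (direction G w a) (w a) j ≡⟨ cong (λ b → traversal b (w a) j) (direction≡dir a) ⟩
        traversal (dir a) (w a) j           ≡⟨ g-block a j ⟨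
        g (combine a j)                     ∎
        where
        open ≡-Reasoning
        open EulerTourOf G simple w-IsEulerTour using (direction-Traverses)
        direction≡dir : ∀ a → direction G w a ≡ dir a
        direction≡dir a = endpoint-injective G simple (w a) (proj₁ (direction-Traverses a))

  -- Rotate h so that the middle of some edge e₀ sits at position (e₀, 1F); then every block is a path.
  HamCycle⇒expand : ∀ {h} → IsHamCycle (LineGraph G′) h →
                    Σ[ t ∈ EulerTour G ] CycEq (expand (proj₁ t)) h
  HamCycle⇒expand {h} ham with Fin-inhabited? (E G)
  ... | no no-edge = edgeless-EulerTour G no-edge , 0 , inj₁ λ x → ⊥-elim (no-edge (quotient {E G} 3 x))
  ... | yes e₀ with proj₁ ham (middle e₀)
  ...   | q , hq≡e₀ , _ with shift-transitive (combine e₀ 1F) q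
  ...     | t , t-anchor with shift-inverse {E G′} t
  ...       | u , back = (w , w-IsEulerTour) , u , inj₁ λ i → begin
    h i                     ≡⟨ cong h (trans (shift-comm t u i) (back i)) ⟨
    h (shift t (shift u i)) ≡⟨ expand-w≡g (shift u i) ⟨
    expand w (shift u i)    ∎
    where
    open ≡-Reasoning
    open HamiltonianCycle (IsHamCycle-∘-shift (LineGraph G′) t ham)
    open Contraction (λ a → middle⇒traversed (middle-everywhere (e₀ , trans (cong h t-anchor) hq≡e₀) a))

lemma14 : (G : Graph) → IsSimple G →
    ClassBij (SameTour G) (SameTour (subdivide G)) ×
    ClassBij (SameTour (subdivide G)) (SameCycle (LineGraph (subdivide G)))
lemma14 G simple =
  record { to         = expandTour
         ; respects   = expand-respects
         ; reflects   = expand-reflects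
         ; surjective = λ t′ → HamCycle⇒expand (tour⇒ham (proj₂ t′)) } ,
  record { to         = λ t′ → proj₁ t′ , tour⇒ham (proj₂ t′)
         ; respects   = λ _ _ same → same
         ; reflects   = λ _ _ same → same
         ; surjective = λ c → let (t , same) = HamCycle⇒expand (proj₂ c) in expandTour t , same }
  where
  open Expansion G simple
  open Subdivision G using (G′)
  tour⇒ham : ∀ {w} → IsEulerTour G′ w → IsHamCycle (LineGraph G′) w
  tour⇒ham = IsEulerTour⇒IsHamCycle G′ (csuc-≢ {E G})
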